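{- Let $F$ be a field and $n\geq 1$. In the ring $M_n(F)$, the center $F\cdot I_n$ is defined by the existential formula (in the language of rings) $\exists \bar u\,\bigl(\varepsilon_n(\bar u)\wedge \delta_n(v,\bar u)\bigr)$, where $\bar u=(u_{ij})_{1\le i,j\le n}$, $$\varepsilon_n(\bar u):\quad \bigwedge_{i,j,t=1}^n \bigl(u_{ij}u_{jt}=u_{it}\ \wedge\ u_{it}\neq 0\bigr)\ \wedge\ \bigwedge_{i,j,s,t=1,\ j\neq s}^n u_{ij}u_{st}=0,$$ $$\delta_n(v,\bar u):\quad \bigwedge_{s,t=1}^n v\,u_{st}=u_{st}\,v.$$ That is, for $V\in M_n(F)$, $V\in F\cdot I_n$ if and only if there exist $U_{ij}\in M_n(F)$ ($1\le i,j\le n$) satisfying $\varepsilon_n$ with $V$ commuting with all $U_{st}$.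
   Context: The language of unital rings is $\mathcal L_{\mathrm{ri}}=\{+,\cdot,-,0,1\}$. -}

module Defs where

open import Level using (_⊔_; suc)
open import Algebra.Bundles using (CommutativeRing)
open import Data.Nat.Base using (ℕ)
open import Data.Fin.Base using (Fin)
open import Data.Fin.Properties using (_≟_)
open import Data.Product using (Σ; ∃; _×_)
open import Relation.Nullary using (¬_; does)
open import Data.Bool.Base using (if_then_else_)
open import Relation.Binary.PropositionalEquality using (_≢_)

record Field c ℓ : Set (Level.suc (c ⊔ ℓ)) where
  field
    commutativeRing : CommutativeRing c ℓ
  open CommutativeRing commutativeRing public
  field
    0≉1     : ¬ (0# ≈ 1#)
    inverse : ∀ x → ¬ (x ≈ 0#) → Σ Carrier λ y → x * y ≈ 1#

module Matrices {c ℓ} (F : Field c ℓ) where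
  open Field F
  open import Algebra.Properties.Monoid.Sum +-monoid using (sum)

  Mat : ℕ → Set c
  Mat n = Fin n → Fin n → Carrier

  _≋_ : ∀ {n} → Mat n → Mat n → Set ℓ
  A ≋ B = ∀ i j → A i j ≈ B i j

  _⊗_ : ∀ {n} → Mat n → Mat n → Mat n
  (A ⊗ B) i k = sum (λ j → A i j * B j k)

  O : ∀ {n} → Mat n
  O _ _ = 0#

  scalar : ∀ {n} → Carrier → Mat n
  scalar a i j = if does (i ≟ j) then a else 0#

  I : ∀ {n} → Mat n
  I = scalar 1#

  InScalars : ∀ {n} → Mat n → Set (c ⊔ ℓ)
  InScalars V = ∃ λ a → V ≋ scalar a

  ε : ∀ {n} → (Fin n → Fin n → Mat n) → Set ℓ
  ε {n} U =
    (∀ (i j t : Fin n) → ((U i j ⊗ U j t) ≋ U i t) × ¬ (U i t ≋ O))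
    × (∀ (i j s t : Fin n) → j ≢ s → (U i j ⊗ U s t) ≋ O)

  δ : ∀ {n} → Mat n → (Fin n → Fin n → Mat n) → Set ℓ
  δ {n} V U = ∀ (s t : Fin n) → (V ⊗ U s t) ≋ (U s t ⊗ V)

{-# OPTIONS --safe #-}
-- A scalar matrix commutes with everything, and the elementary matrices E_ij satisfy ε.
-- Conversely, ε makes the U_ij a system of matrix units with u = U_00 a nonzero idempotent. Over a
-- field some functional φ = ⟨ C , _ ⟩ has φ(u) = 1: det (I - u) ≡ 1 modulo the entries of u, while
-- det (I - u) · u = 0. The functionals ψ_ij(X) = φ(U_0i X U_j0) satisfy ψ_ij(U_kl) = δ_ik δ_jl, so,
-- flattening matrices to vectors of length n², the ψ's form a left inverse of the U's; by
-- multiplicativity of the determinant it is also a right inverse, i.e. the U_ij span M_n(F). If V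
-- commutes with every U_ij then ψ_ij(V) = δ_ij φ(V u), so V = φ(V u) Σ_i U_ii, and V = I shows
-- Σ_i U_ii = I.
module Submission where

open import Defs
open import Level using (_⊔_)
open import Algebra.Bundles using (CommutativeRing)
open import Data.Nat.Base as ℕ using (ℕ; zero; suc; _≤_; s≤s; z≤n)
import Data.Nat.Properties as ℕP
open import Data.Fin.Base as Fin
  using (Fin; zero; suc; toℕ; fromℕ<; punchIn; punchOut; combine; remQuot; _↑ˡ_; _↑ʳ_)
open import Data.Fin.Properties
  using ( _≟_; toℕ-injective; toℕ-fromℕ<; toℕ<n; any?; pigeonhole; punchInᵢ≢i; punchIn-punchOut
        ; punchIn-injective; punchOut-injective; remQuot-combine; combine-remQuot)
import Data.Fin.Properties as FinP
open import Data.Fin.Permutation.Components using (transpose)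
open import Data.Vec.Functional using (updateAt)
open import Data.Vec.Functional.Properties
  using (updateAt-updates; updateAt-minimal; updateAt-commutes; updateAt-id-local)
open import Data.Product using (Σ; ∃; ∃₂; _×_; _,_; proj₁; proj₂; uncurry)
open import Data.Sum using (_⊎_; inj₁; inj₂)
open import Data.Bool.Base using (if_then_else_)
open import Data.Empty using (⊥-elim)
open import Function.Base using (_∘_; const)
open import Function.Bundles using (_⇔_; mk⇔)
open import Relation.Nullary using (¬_; Dec; yes; no; does)
open import Relation.Nullary.Decidable using (dec-true; dec-false)
open import Relation.Binary.Definitions using (tri<; tri≈; tri>)
open import Relation.Binary.PropositionalEquality as ≡ using (_≡_; _≢_; _≗_)
import Algebra.Properties.CommutativeMonoid.Sum as CommutativeMonoidSum
import Algebra.Properties.CommutativeSemigroup as CommutativeSemigroupProperties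
import Algebra.Properties.Monoid.Sum as MonoidSum
import Algebra.Properties.Semiring.Sum as SemiringSum
import Algebra.Properties.Ring as RingProperties
import Algebra.Properties.Group as GroupProperties
import Algebra.Solver.Ring.NaturalCoefficients.Default as NaturalCoefficients

transpose-left : ∀ {n} (i j : Fin n) → transpose i j i ≡ j
transpose-left i j rewrite dec-true (i ≟ i) ≡.refl = ≡.refl

transpose-right : ∀ {n} {i j : Fin n} → i ≢ j → transpose i j j ≡ i
transpose-right {i = i} {j} i≢j
  rewrite dec-false (j ≟ i) (i≢j ∘ ≡.sym) | dec-true (j ≟ j) ≡.refl = ≡.refl

transpose-other : ∀ {n} {i j k : Fin n} → k ≢ i → k ≢ j → transpose i j k ≡ k
transpose-other {i = i} {j} {k} k≢i k≢j
  rewrite dec-false (k ≟ i) k≢i | dec-false (k ≟ j) k≢j = ≡.refl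

flatten : ∀ {a} {A : Set a} {n} → (Fin n → Fin n → A) → Fin (n ℕ.* n) → A
flatten {n = n} f x = uncurry f (remQuot n x)

module MatrixAlgebra {c ℓ} (R : CommutativeRing c ℓ) where
  open CommutativeRing R hiding (zero)
  open import Relation.Binary.Reasoning.Setoid setoid
  open MonoidSum +-monoid public using (sum) renaming (sum-cong-≋ to sum-cong)
  open CommutativeMonoidSum +-commutativeMonoid public using (∑-distrib-+; ∑-comm; sum-remove)
  open SemiringSum semiring public using (*-distribˡ-sum; *-distribʳ-sum)
  open CommutativeSemigroupProperties *-commutativeSemigroup using (x∙yz≈y∙xz; x∙yz≈xz∙y; x∙yz≈yx∙z)
  open NaturalCoefficients commutativeSemiring using (solve; _:=_; _:*_)

  Mat : ℕ → Set c
  Mat n = Fin n → Fin n → Carrier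

  infix 4 _≋_
  _≋_ : ∀ {n} → Mat n → Mat n → Set ℓ
  A ≋ B = ∀ i j → A i j ≈ B i j

  ≋-sym : ∀ {n} {A B : Mat n} → A ≋ B → B ≋ A
  ≋-sym A≋B i j = sym (A≋B i j)

  ≋-trans : ∀ {n} {A B C : Mat n} → A ≋ B → B ≋ C → A ≋ C
  ≋-trans A≋B B≋C i j = trans (A≋B i j) (B≋C i j)

  I : ∀ {n} → Mat n
  I i j = if does (i ≟ j) then 1# else 0#

  O : ∀ {n} → Mat n
  O _ _ = 0#

  infixl 7 _⊗_ _·_
  _⊗_ : ∀ {n} → Mat n → Mat n → Mat n
  (A ⊗ B) i k = sum (λ j → A i j * B j k)

  _·_ : ∀ {n} → Carrier → Mat n → Mat n
  (a · A) i j = a * A i j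

  infixl 6 _⊖_
  _⊖_ : ∀ {n} → Mat n → Mat n → Mat n
  (A ⊖ B) i j = A i j - B i j

  _ᵀ : ∀ {n} → Mat n → Mat n
  (A ᵀ) i j = A j i

  ⟨_,_⟩ : ∀ {n} → Mat n → Mat n → Carrier
  ⟨ A , B ⟩ = sum (λ i → sum (λ j → A i j * B i j))

  I-diagonal : ∀ {n} (i : Fin n) → I i i ≈ 1#
  I-diagonal i with i ≟ i
  ... | yes _ = refl
  ... | no i≢i = ⊥-elim (i≢i ≡.refl)

  I-off-diagonal : ∀ {n} {i j : Fin n} → i ≢ j → I i j ≈ 0#
  I-off-diagonal {i = i} {j} i≢j with i ≟ j
  ... | yes i≡j = ⊥-elim (i≢j i≡j)
  ... | no _ = refl

  I-sym : ∀ {n} (i j : Fin n) → I i j ≈ I j i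
  I-sym i j with i ≟ j | j ≟ i
  ... | yes _ | yes _ = refl
  ... | no _  | no _  = refl
  ... | yes i≡j | no j≢i = ⊥-elim (j≢i (≡.sym i≡j))
  ... | no i≢j | yes j≡i = ⊥-elim (i≢j (≡.sym j≡i))

  I-suc : ∀ {n} (i j : Fin n) → I (suc i) (suc j) ≈ I i j
  I-suc i j with i ≟ j
  ... | yes _ = refl
  ... | no _ = refl

  sum-zero : ∀ {n} {f : Fin n → Carrier} → (∀ i → f i ≈ 0#) → sum f ≈ 0#
  sum-zero {zero} _ = refl
  sum-zero {suc n} f≈0 = trans (+-cong (f≈0 zero) (sum-zero (λ i → f≈0 (suc i)))) (+-identityˡ 0#)

  sum-single : ∀ {n} (f : Fin n → Carrier) (p : Fin n) → (∀ i → i ≢ p → f i ≈ 0#) → sum f ≈ f p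
  sum-single {suc n} f p vanish = begin
    sum f                              ≈⟨ sum-remove f ⟩
    f p + sum (λ i → f (punchIn p i))  ≈⟨ +-congˡ (sum-zero (λ i → vanish _ (punchInᵢ≢i p i))) ⟩
    f p + 0#                           ≈⟨ +-identityʳ _ ⟩
    f p                                ∎

  sum-pair : ∀ {n} (f : Fin n → Carrier) {p q : Fin n} → p ≢ q →
             (∀ i → i ≢ p → i ≢ q → f i ≈ 0#) → sum f ≈ f p + f q
  sum-pair {suc n} f {p} {q} p≢q vanish = begin
    sum f                              ≈⟨ sum-remove f ⟩
    f p + sum (λ i → f (punchIn p i))  ≈⟨ +-congˡ (sum-single _ _ off-q) ⟩
    f p + f (punchIn p (punchOut p≢q)) ≡⟨ ≡.cong (λ r → f p + f r) (punchIn-punchOut p≢q) ⟩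
    f p + f q                          ∎
    where
    off-q : ∀ i → i ≢ punchOut p≢q → f (punchIn p i) ≈ 0#
    off-q i i≢ = vanish _ (punchInᵢ≢i p i)
      (λ e → i≢ (punchIn-injective p _ _ (≡.trans e (≡.sym (punchIn-punchOut p≢q)))))

  sum-*I : ∀ {n} (f : Fin n → Carrier) (t : Fin n) → sum (λ j → f j * I j t) ≈ f t
  sum-*I f t = trans (sum-single _ t (λ j j≢t → trans (*-congˡ (I-off-diagonal j≢t)) (zeroʳ _)))
                     (trans (*-congˡ (I-diagonal t)) (*-identityʳ _))

  sum-I* : ∀ {n} (f : Fin n → Carrier) (s : Fin n) → sum (λ j → I s j * f j) ≈ f s
  sum-I* f s = trans (sum-cong (λ j → *-comm (I s j) (f j)))
                     (trans (sum-cong (λ j → *-congˡ (I-sym s j))) (sum-*I f s))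

  sum-combine : ∀ {m n} (f : Fin (m ℕ.* n) → Carrier) →
                sum f ≈ sum (λ i → sum (λ j → f (combine {m} {n} i j)))
  sum-combine {zero} f = refl
  sum-combine {suc m} {n} f = trans (sum-++ {n} {m ℕ.* n} f) (+-congˡ (sum-combine {m} (λ k → f (n ↑ʳ k))))
    where
    sum-++ : ∀ {a b} (g : Fin (a ℕ.+ b) → Carrier) → sum g ≈ sum (λ i → g (i ↑ˡ b)) + sum (λ k → g (a ↑ʳ k))
    sum-++ {zero} g = sym (+-identityˡ _)
    sum-++ {suc a} {b} g = trans (+-congˡ (sum-++ {a} {b} (λ x → g (suc x)))) (sym (+-assoc _ _ _))

  ⊗-cong : ∀ {n} {A A′ B B′ : Mat n} → A ≋ A′ → B ≋ B′ → A ⊗ B ≋ A′ ⊗ B′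
  ⊗-cong A≋A′ B≋B′ i k = sum-cong (λ j → *-cong (A≋A′ i j) (B≋B′ j k))

  ⊗-congˡ : ∀ {n} {A A′ : Mat n} (B : Mat n) → A ≋ A′ → A ⊗ B ≋ A′ ⊗ B
  ⊗-congˡ B A≋A′ = ⊗-cong A≋A′ (λ _ _ → refl)

  ⊗-congʳ : ∀ {n} (A : Mat n) {B B′ : Mat n} → B ≋ B′ → A ⊗ B ≋ A ⊗ B′
  ⊗-congʳ A = ⊗-cong (λ _ _ → refl)

  ⊗-identityˡ : ∀ {n} (A : Mat n) → I ⊗ A ≋ A
  ⊗-identityˡ A i k = sum-I* (λ j → A j k) i

  ⊗-identityʳ : ∀ {n} (A : Mat n) → A ⊗ I ≋ A
  ⊗-identityʳ A i k = sum-*I (A i) k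

  ⊗-zeroˡ : ∀ {n} (A : Mat n) → O ⊗ A ≋ O
  ⊗-zeroˡ A i k = sum-zero (λ j → zeroˡ (A j k))

  ⊗-assoc : ∀ {n} (A B C : Mat n) → (A ⊗ B) ⊗ C ≋ A ⊗ (B ⊗ C)
  ⊗-assoc A B C i k = begin
    sum (λ l → sum (λ j → A i j * B j l) * C l k)        ≈⟨ sum-cong (λ l → *-distribʳ-sum (C l k) (λ j → A i j * B j l)) ⟩
    sum (λ l → sum (λ j → (A i j * B j l) * C l k))      ≈⟨ ∑-comm (λ l j → (A i j * B j l) * C l k) ⟩
    sum (λ j → sum (λ l → (A i j * B j l) * C l k))      ≈⟨ sum-cong (λ j → sum-cong (λ l → *-assoc (A i j) (B j l) (C l k))) ⟩
    sum (λ j → sum (λ l → A i j * (B j l * C l k)))      ≈˘⟨ sum-cong (λ j → *-distribˡ-sum (A i j) (λ l → B j l * C l k)) ⟩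
    sum (λ j → A i j * sum (λ l → B j l * C l k))        ∎

  ·-⊗ : ∀ {n} (a : Carrier) (A B : Mat n) → (a · A) ⊗ B ≋ a · (A ⊗ B)
  ·-⊗ a A B i k = trans (sum-cong (λ j → *-assoc a (A i j) (B j k))) (sym (*-distribˡ-sum a (λ j → A i j * B j k)))

  ⊗-· : ∀ {n} (a : Carrier) (A B : Mat n) → A ⊗ (a · B) ≋ a · (A ⊗ B)
  ⊗-· a A B i k = trans (sum-cong (λ j → x∙yz≈y∙xz (A i j) a (B j k))) (sym (*-distribˡ-sum a (λ j → A i j * B j k)))

  ⟨⟩-comm : ∀ {n} (A B : Mat n) → ⟨ A , B ⟩ ≈ ⟨ B , A ⟩
  ⟨⟩-comm A B = sum-cong (λ i → sum-cong (λ j → *-comm (A i j) (B i j)))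

  ⟨⟩-congʳ : ∀ {n} (A : Mat n) {B B′ : Mat n} → B ≋ B′ → ⟨ A , B ⟩ ≈ ⟨ A , B′ ⟩
  ⟨⟩-congʳ A B≋B′ = sum-cong (λ i → sum-cong (λ j → *-congˡ (B≋B′ i j)))

  ⟨⟩-·ʳ : ∀ {n} (A : Mat n) (a : Carrier) (B : Mat n) → ⟨ A , a · B ⟩ ≈ a * ⟨ A , B ⟩
  ⟨⟩-·ʳ A a B = begin
    sum (λ i → sum (λ j → A i j * (a * B i j)))  ≈⟨ sum-cong (λ i → sum-cong (λ j → x∙yz≈y∙xz (A i j) a (B i j))) ⟩
    sum (λ i → sum (λ j → a * (A i j * B i j)))  ≈˘⟨ sum-cong (λ i → *-distribˡ-sum a (λ j → A i j * B i j)) ⟩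
    sum (λ i → a * sum (λ j → A i j * B i j))    ≈˘⟨ *-distribˡ-sum a (λ i → sum (λ j → A i j * B i j)) ⟩
    a * ⟨ A , B ⟩                                ∎

  ⟨⟩-⊗ʳ : ∀ {n} (A Y Z : Mat n) → ⟨ A , Y ⊗ Z ⟩ ≈ ⟨ A ⊗ Z ᵀ , Y ⟩
  ⟨⟩-⊗ʳ A Y Z = sum-cong λ i → begin
    sum (λ k → A i k * sum (λ j → Y i j * Z j k))      ≈⟨ sum-cong (λ k → *-distribˡ-sum (A i k) (λ j → Y i j * Z j k)) ⟩
    sum (λ k → sum (λ j → A i k * (Y i j * Z j k)))    ≈⟨ ∑-comm (λ k j → A i k * (Y i j * Z j k)) ⟩
    sum (λ j → sum (λ k → A i k * (Y i j * Z j k)))    ≈⟨ sum-cong (λ j → sum-cong (λ k → x∙yz≈xz∙y (A i k) (Y i j) (Z j k))) ⟩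
    sum (λ j → sum (λ k → (A i k * Z j k) * Y i j))    ≈˘⟨ sum-cong (λ j → *-distribʳ-sum (Y i j) (λ k → A i k * Z j k)) ⟩
    sum (λ j → (A ⊗ Z ᵀ) i j * Y i j)                  ∎

  ⟨⟩-⊗ˡ : ∀ {n} (A B Y : Mat n) → ⟨ A , B ⊗ Y ⟩ ≈ ⟨ B ᵀ ⊗ A , Y ⟩
  ⟨⟩-⊗ˡ A B Y = begin
    sum (λ i → sum (λ k → A i k * sum (λ j → B i j * Y j k)))
      ≈⟨ sum-cong (λ i → sum-cong (λ k → *-distribˡ-sum (A i k) (λ j → B i j * Y j k))) ⟩
    sum (λ i → sum (λ k → sum (λ j → A i k * (B i j * Y j k))))
      ≈⟨ sum-cong (λ i → ∑-comm (λ k j → A i k * (B i j * Y j k))) ⟩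
    sum (λ i → sum (λ j → sum (λ k → A i k * (B i j * Y j k))))
      ≈⟨ ∑-comm (λ i j → sum (λ k → A i k * (B i j * Y j k))) ⟩
    sum (λ j → sum (λ i → sum (λ k → A i k * (B i j * Y j k))))
      ≈⟨ sum-cong (λ j → ∑-comm (λ i k → A i k * (B i j * Y j k))) ⟩
    sum (λ j → sum (λ k → sum (λ i → A i k * (B i j * Y j k))))
      ≈⟨ sum-cong (λ j → sum-cong (λ k → sum-cong (λ i → x∙yz≈yx∙z (A i k) (B i j) (Y j k)))) ⟩
    sum (λ j → sum (λ k → sum (λ i → (B i j * A i k) * Y j k)))
      ≈˘⟨ sum-cong (λ j → sum-cong (λ k → *-distribʳ-sum (Y j k) (λ i → B i j * A i k))) ⟩
    ⟨ B ᵀ ⊗ A , Y ⟩ ∎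

  UnitRelations : ∀ {n} → (Fin n → Fin n → Mat n) → Set ℓ
  UnitRelations {n} U = ∀ a b s t → U a b ⊗ U s t ≋ I b s · U a t

  elementary : ∀ {n} → Fin n → Fin n → Mat n
  elementary a b p q = I p a * I b q

  elementary-units : ∀ {n} → UnitRelations (elementary {n})
  elementary-units a b s t p q = begin
    sum (λ x → (I p a * I b x) * (I x s * I t q))  ≈⟨ sum-cong (λ x → rearrange (I p a) (I b x) (I x s) (I t q)) ⟩
    sum (λ x → I b x * (I x s * (I p a * I t q)))  ≈⟨ sum-I* (λ x → I x s * (I p a * I t q)) b ⟩
    I b s * (I p a * I t q)                        ∎
    where
    rearrange : ∀ x y z w → (x * y) * (z * w) ≈ y * (z * (x * w))
    rearrange = solve 4 (λ x y z w → (x :* y) :* (z :* w) := y :* (z :* (x :* w))) refl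

  ·I-central : ∀ {n} a (X : Mat n) → (a · I) ⊗ X ≋ X ⊗ (a · I)
  ·I-central a X p q = begin
    ((a · I) ⊗ X) p q   ≈⟨ ·-⊗ a I X p q ⟩
    a * (I ⊗ X) p q     ≈⟨ *-congˡ (trans (⊗-identityˡ X p q) (sym (⊗-identityʳ X p q))) ⟩
    a * (X ⊗ I) p q     ≈˘⟨ ⊗-· a X I p q ⟩
    (X ⊗ (a · I)) p q   ∎

module Determinant {c ℓ} (R : CommutativeRing c ℓ) where
  open CommutativeRing R hiding (zero)
  open MatrixAlgebra R
  open import Relation.Binary.Reasoning.Setoid setoid
  open RingProperties ring using (-‿distribˡ-*; -‿distribʳ-*)
  open CommutativeSemigroupProperties *-commutativeSemigroup using (xy∙z≈x∙zy)
  open NaturalCoefficients commutativeSemiring using (solve; _:=_; _:+_; _:*_)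

  sign : ℕ → Carrier
  sign zero = 1#
  sign (suc k) = - sign k

  minor : ∀ {n} → Fin (suc n) → Mat (suc n) → Mat n
  minor i A r c = A (punchIn i r) (suc c)

  det : ∀ {n} → Mat n → Carrier
  det {zero} A = 1#
  det {suc n} A = sum (λ i → sign (toℕ i) * (A i zero * det (minor i A)))

  det-cong : ∀ {n} {A B : Mat n} → A ≋ B → det A ≈ det B
  det-cong {zero} A≋B = refl
  det-cong {suc n} A≋B =
    sum-cong (λ i → *-congˡ {sign (toℕ i)} (*-cong (A≋B i zero) (det-cong (λ r c → A≋B (punchIn i r) (suc c)))))

  RowLinear : ∀ {n} → (Mat n → Carrier) → Set (c ⊔ ℓ)
  RowLinear {n} D = ∀ (k : Fin n) (A B C : Mat n) (α β : Carrier) →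
    (∀ r → r ≢ k → ∀ c → A r c ≈ C r c) → (∀ r → r ≢ k → ∀ c → B r c ≈ C r c) →
    (∀ c → C k c ≈ α * A k c + β * B k c) → D C ≈ α * D A + β * D B

  det-row-linear : ∀ {n} → RowLinear (det {n})
  det-row-linear {suc n} k A B C α β A≈C B≈C Cₖ = begin
    det C                                 ≈⟨ sum-cong expand-term ⟩
    sum (λ i → α * tA i + β * tB i)       ≈⟨ ∑-distrib-+ (λ i → α * tA i) (λ i → β * tB i) ⟩
    sum (λ i → α * tA i) + sum (λ i → β * tB i)
                                          ≈˘⟨ +-cong (*-distribˡ-sum α tA) (*-distribˡ-sum β tB) ⟩
    α * det A + β * det B                 ∎
    where
    tA tB : Fin (suc n) → Carrier
    tA i = sign (toℕ i) * (A i zero * det (minor i A))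
    tB i = sign (toℕ i) * (B i zero * det (minor i B))
    expand-term : ∀ i → sign (toℕ i) * (C i zero * det (minor i C)) ≈ α * tA i + β * tB i
    expand-term i with i ≟ k
    ... | yes ≡.refl = begin
      sign (toℕ i) * (C i zero * det (minor i C))
        ≈⟨ *-congˡ (*-cong (Cₖ zero) (det-cong minorC≋minorA)) ⟩
      sign (toℕ i) * ((α * A i zero + β * B i zero) * det (minor i A))
        ≈⟨ solve 6 (λ s a b x y d → s :* ((x :* a :+ y :* b) :* d) := x :* (s :* (a :* d)) :+ y :* (s :* (b :* d))) refl
                   (sign (toℕ i)) (A i zero) (B i zero) α β (det (minor i A)) ⟩
      α * tA i + β * (sign (toℕ i) * (B i zero * det (minor i A)))
        ≈⟨ +-congˡ (*-congˡ (*-congˡ (*-congˡ (det-cong minorA≋minorB)))) ⟩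
      α * tA i + β * tB i ∎
      where
      minorC≋minorA : minor i C ≋ minor i A
      minorC≋minorA r c = sym (A≈C (punchIn i r) (punchInᵢ≢i i r) (suc c))
      minorA≋minorB : minor i A ≋ minor i B
      minorA≋minorB r c = trans (A≈C (punchIn i r) (punchInᵢ≢i i r) (suc c))
                                (sym (B≈C (punchIn i r) (punchInᵢ≢i i r) (suc c)))
    ... | no i≢k = begin
      sign (toℕ i) * (C i zero * det (minor i C))
        ≈⟨ *-congˡ (*-cong (sym (A≈C i i≢k zero)) minor-linear) ⟩
      sign (toℕ i) * (A i zero * (α * det (minor i A) + β * det (minor i B)))
        ≈⟨ solve 6 (λ s a x y d e → s :* (a :* (x :* d :+ y :* e)) := x :* (s :* (a :* d)) :+ y :* (s :* (a :* e))) refl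
                   (sign (toℕ i)) (A i zero) α β (det (minor i A)) (det (minor i B)) ⟩
      α * tA i + β * (sign (toℕ i) * (A i zero * det (minor i B)))
        ≈⟨ +-congˡ (*-congˡ (*-congˡ (*-congʳ (trans (A≈C i i≢k zero) (sym (B≈C i i≢k zero)))))) ⟩
      α * tA i + β * tB i ∎
      where
      k′ = punchOut i≢k
      off-k′ : ∀ r → r ≢ k′ → punchIn i r ≢ k
      off-k′ r r≢k′ e = r≢k′ (punchIn-injective i r k′ (≡.trans e (≡.sym (punchIn-punchOut i≢k))))
      minor-linear : det (minor i C) ≈ α * det (minor i A) + β * det (minor i B)
      minor-linear = det-row-linear k′ (minor i A) (minor i B) (minor i C) α β
        (λ r r≢k′ c → A≈C (punchIn i r) (off-k′ r r≢k′) (suc c))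
        (λ r r≢k′ c → B≈C (punchIn i r) (off-k′ r r≢k′) (suc c))
        (λ c → ≡.subst (λ z → C z (suc c) ≈ α * A z (suc c) + β * B z (suc c))
                       (≡.sym (punchIn-punchOut i≢k)) (Cₖ (suc c)))

  data Adjacent : ∀ {n} → Fin n → Fin n → Set where
    adjacent-zero : ∀ {n} → Adjacent {suc (suc n)} zero (suc zero)
    adjacent-suc  : ∀ {n} {p q : Fin (suc n)} → Adjacent p q → Adjacent {suc (suc n)} (suc p) (suc q)

  adjacent-toℕ : ∀ {n} {p q : Fin n} → Adjacent p q → toℕ q ≡ suc (toℕ p)
  adjacent-toℕ adjacent-zero = ≡.refl
  adjacent-toℕ (adjacent-suc p~q) = ≡.cong suc (adjacent-toℕ p~q)

  toℕ⇒adjacent : ∀ {n} {p q : Fin n} → toℕ q ≡ suc (toℕ p) → Adjacent p q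
  toℕ⇒adjacent {p = zero} {suc zero} _ = adjacent-zero
  toℕ⇒adjacent {suc (suc n)} {suc p} {suc q} e = adjacent-suc (toℕ⇒adjacent (ℕP.suc-injective e))
  toℕ⇒adjacent {p = zero} {zero} ()
  toℕ⇒adjacent {p = zero} {suc (suc q)} ()
  toℕ⇒adjacent {p = suc p} {zero} ()

  adjacent⇒≢ : ∀ {n} {p q : Fin n} → Adjacent p q → p ≢ q
  adjacent⇒≢ p~q ≡.refl = ℕP.1+n≢n (≡.sym (adjacent-toℕ p~q))

  adjacent-punchOut : ∀ {n} {p q : Fin (suc n)} → Adjacent p q → ∀ i (i≢p : i ≢ p) (i≢q : i ≢ q) →
                      Adjacent (punchOut i≢p) (punchOut i≢q)
  adjacent-punchOut adjacent-zero zero i≢p i≢q = ⊥-elim (i≢p ≡.refl)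
  adjacent-punchOut adjacent-zero (suc zero) i≢p i≢q = ⊥-elim (i≢q ≡.refl)
  adjacent-punchOut (adjacent-zero {suc n}) (suc (suc i)) i≢p i≢q = adjacent-zero
  adjacent-punchOut (adjacent-suc p~q) zero i≢p i≢q = p~q
  adjacent-punchOut (adjacent-suc {suc n} p~q) (suc i) i≢p i≢q = adjacent-suc (adjacent-punchOut p~q i _ _)

  adjacent-punchIn : ∀ {n} {p q : Fin (suc n)} → Adjacent p q → ∀ r →
                     punchIn p r ≡ punchIn q r ⊎ (punchIn p r ≡ q × punchIn q r ≡ p)
  adjacent-punchIn adjacent-zero zero = inj₂ (≡.refl , ≡.refl)
  adjacent-punchIn adjacent-zero (suc r) = inj₁ ≡.refl
  adjacent-punchIn (adjacent-suc p~q) zero = inj₁ ≡.refl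
  adjacent-punchIn (adjacent-suc p~q) (suc r) with adjacent-punchIn p~q r
  ... | inj₁ e = inj₁ (≡.cong suc e)
  ... | inj₂ (e₁ , e₂) = inj₂ (≡.cong suc e₁ , ≡.cong suc e₂)

  AdjacentAlternating : ∀ {n} → (Mat n → Carrier) → Set (c ⊔ ℓ)
  AdjacentAlternating {n} D = ∀ {p q : Fin n} → Adjacent p q → ∀ A → (∀ c → A p c ≈ A q c) → D A ≈ 0#

  det-adjacent-alternating : ∀ {n} → AdjacentAlternating (det {n})
  det-adjacent-alternating {suc n} {p} {q} p~q A Aₚ≈A_q =
    trans (sum-pair _ (adjacent⇒≢ p~q) other-terms) cancel
    where
    other-terms : ∀ i → i ≢ p → i ≢ q → sign (toℕ i) * (A i zero * det (minor i A)) ≈ 0#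
    other-terms i i≢p i≢q = trans (*-congˡ (trans (*-congˡ minor-vanishes) (zeroʳ _))) (zeroʳ _)
      where
      minor-vanishes : det (minor i A) ≈ 0#
      minor-vanishes = det-adjacent-alternating (adjacent-punchOut p~q i i≢p i≢q) (minor i A)
        (λ c → ≡.subst₂ (λ z w → A z (suc c) ≈ A w (suc c))
                 (≡.sym (punchIn-punchOut i≢p)) (≡.sym (punchIn-punchOut i≢q)) (Aₚ≈A_q (suc c)))
    minor-q≋minor-p : minor q A ≋ minor p A
    minor-q≋minor-p r c with adjacent-punchIn p~q r
    ... | inj₁ e = ≡.subst (λ z → A (punchIn q r) (suc c) ≈ A z (suc c)) (≡.sym e) refl
    ... | inj₂ (e₁ , e₂) = ≡.subst₂ (λ z w → A w (suc c) ≈ A z (suc c)) (≡.sym e₁) (≡.sym e₂) (Aₚ≈A_q (suc c))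
    cancel : sign (toℕ p) * (A p zero * det (minor p A)) + sign (toℕ q) * (A q zero * det (minor q A)) ≈ 0#
    cancel rewrite adjacent-toℕ p~q = begin
      sign (toℕ p) * x + - sign (toℕ p) * (A q zero * det (minor q A))
        ≈⟨ +-congˡ (*-congˡ (*-cong (sym (Aₚ≈A_q zero)) (det-cong minor-q≋minor-p))) ⟩
      sign (toℕ p) * x + - sign (toℕ p) * x  ≈˘⟨ +-congˡ (-‿distribˡ-* _ x) ⟩
      sign (toℕ p) * x + - (sign (toℕ p) * x) ≈⟨ -‿inverseʳ _ ⟩
      0#                                      ∎
      where
      x = A p zero * det (minor p A)

  record Multilinear {n} (D : Mat n → Carrier) : Set (c ⊔ ℓ) where
    field
      cong                  : ∀ {A B} → A ≋ B → D A ≈ D B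
      row-linear            : RowLinear D
      adjacent-alternating  : AdjacentAlternating D

  det-multilinear : ∀ {n} → Multilinear (det {n})
  det-multilinear = record
    { cong = det-cong ; row-linear = det-row-linear ; adjacent-alternating = det-adjacent-alternating }

  -- Expanding along the first column, every term except the first carries an entry of the first
  -- column of u; the first term is (1 - u₀₀) times the same determinant for the lower-right block.
  det[I⊖u]≡1-mod-entries : ∀ {n} (u : Mat n) → ∃ λ C → det (I ⊖ u) + ⟨ C , u ⟩ ≈ 1#
  det[I⊖u]≡1-mod-entries {zero} u = (λ ()) , +-identityʳ 1#
  det[I⊖u]≡1-mod-entries {suc n} u = C , (begin
    (t₀ + sum t) + ((d′ * a + sum (λ j → 0# * u zero (suc j))) + sum (λ i → e i + sum (λ j → C′ i j * u′ i j)))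
      ≈⟨ +-congˡ (+-cong (trans (+-congˡ (sum-zero (λ j → zeroˡ (u zero (suc j))))) (+-identityʳ _))
                         (∑-distrib-+ e (λ i → sum (λ j → C′ i j * u′ i j)))) ⟩
    (t₀ + sum t) + (d′ * a + (sum e + ⟨ C′ , u′ ⟩))
      ≈⟨ solve 5 (λ x y z w v → (x :+ y) :+ (z :+ (w :+ v)) := (x :+ z) :+ ((y :+ w) :+ v)) refl t₀ (sum t) (d′ * a) (sum e) ⟨ C′ , u′ ⟩ ⟩
    (t₀ + d′ * a) + ((sum t + sum e) + ⟨ C′ , u′ ⟩)
      ≈⟨ +-cong first-terms (trans (+-congʳ (trans (sym (∑-distrib-+ t e)) (sum-zero cancel))) (+-identityˡ _)) ⟩
    d′ + ⟨ C′ , u′ ⟩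
      ≈⟨ proj₂ (det[I⊖u]≡1-mod-entries u′) ⟩
    1# ∎)
    where
    u′ : Mat n
    u′ r c = u (suc r) (suc c)
    C′ = proj₁ (det[I⊖u]≡1-mod-entries u′)
    a = u zero zero
    d′ = det (I ⊖ u′)
    m : Fin n → Carrier
    m i = sign (toℕ (Fin.suc i)) * det (minor (suc i) (I ⊖ u))
    C : Mat (suc n)
    C zero zero = d′
    C zero (suc j) = 0#
    C (suc i) zero = m i
    C (suc i) (suc j) = C′ i j
    t₀ = sign 0 * ((I ⊖ u) zero zero * det (minor zero (I ⊖ u)))
    t e : Fin n → Carrier
    t i = sign (toℕ (Fin.suc i)) * ((I ⊖ u) (suc i) zero * det (minor (suc i) (I ⊖ u)))
    e i = m i * u (suc i) zero
    minor-I⊖u : minor zero (I ⊖ u) ≋ I ⊖ u′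
    minor-I⊖u r c = +-congʳ (I-suc r c)
    first-terms : t₀ + d′ * a ≈ d′
    first-terms = begin
      1# * ((1# - a) * det (minor zero (I ⊖ u))) + d′ * a
        ≈⟨ +-congʳ (trans (*-identityˡ _) (*-congˡ (det-cong minor-I⊖u))) ⟩
      (1# - a) * d′ + d′ * a   ≈⟨ +-congˡ (*-comm d′ a) ⟩
      (1# - a) * d′ + a * d′   ≈˘⟨ distribʳ d′ (1# - a) a ⟩
      ((1# - a) + a) * d′      ≈⟨ *-congʳ (trans (+-assoc 1# (- a) a) (trans (+-congˡ (-‿inverseˡ a)) (+-identityʳ 1#))) ⟩
      1# * d′                  ≈⟨ *-identityˡ d′ ⟩
      d′                       ∎
    cancel : ∀ i → t i + e i ≈ 0#
    cancel i = begin
      s * ((0# - x) * d) + (s * d) * x  ≈⟨ +-congʳ (*-congˡ (*-congʳ (+-identityˡ (- x)))) ⟩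
      s * (- x * d) + (s * d) * x       ≈˘⟨ +-congʳ (*-congˡ (-‿distribˡ-* x d)) ⟩
      s * - (x * d) + (s * d) * x       ≈˘⟨ +-congʳ (-‿distribʳ-* s (x * d)) ⟩
      - (s * (x * d)) + (s * d) * x     ≈⟨ +-congˡ (xy∙z≈x∙zy s d x) ⟩
      - (s * (x * d)) + s * (x * d)     ≈⟨ -‿inverseˡ _ ⟩
      0#                                ∎
      where
      s = sign (toℕ (Fin.suc i))
      x = u (suc i) zero
      d = det (minor (suc i) (I ⊖ u))

module MultilinearForms {c ℓ} (R : CommutativeRing c ℓ) where
  open CommutativeRing R hiding (zero)
  open MatrixAlgebra R
  open Determinant R
  open import Relation.Binary.Reasoning.Setoid setoid
  open RingProperties ring using (-‿distribˡ-*; -‿involutive)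
  open GroupProperties +-group using (inverseʳ-unique; ε⁻¹≈ε)
  open NaturalCoefficients commutativeSemiring using (solve; _:=_; _:+_; _:*_)

  Row : ℕ → Set c
  Row n = Fin n → Carrier

  infixl 6 _[_]≔_
  _[_]≔_ : ∀ {n} → Mat n → Fin n → Row n → Mat n
  A [ k ]≔ x = updateAt A k (const x)

  ≗⇒≋ : ∀ {n} {A B : Mat n} → A ≗ B → A ≋ B
  ≗⇒≋ A≗B r c = reflexive (≡.cong (λ row → row c) (A≗B r))

  updated-row : ∀ {n} (A : Mat n) k x c → (A [ k ]≔ x) k c ≈ x c
  updated-row A k x c = reflexive (≡.cong (λ row → row c) (updateAt-updates k A))

  other-row : ∀ {n} (A : Mat n) {k r} x → r ≢ k → ∀ c → (A [ k ]≔ x) r c ≈ A r c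
  other-row A {k} {r} x r≢k c = reflexive (≡.cong (λ row → row c) (updateAt-minimal r k A r≢k))

  update-cong : ∀ {n} (A : Mat n) k {x y : Row n} → (∀ c → x c ≈ y c) → A [ k ]≔ x ≋ A [ k ]≔ y
  update-cong A k x≈y r c with r ≟ k
  ... | yes ≡.refl = trans (updated-row A r _ c) (trans (x≈y c) (sym (updated-row A r _ c)))
  ... | no r≢k = trans (other-row A _ r≢k c) (sym (other-row A _ r≢k c))

  module _ {n} {D : Mat n → Carrier} (D-multilinear : Multilinear D) where
    open Multilinear D-multilinear

    linear-at : ∀ (A : Mat n) k α β (x y : Row n) →
                D (A [ k ]≔ (λ c → α * x c + β * y c)) ≈ α * D (A [ k ]≔ x) + β * D (A [ k ]≔ y)
    linear-at A k α β x y = row-linear k (A [ k ]≔ x) (A [ k ]≔ y) (A [ k ]≔ (λ c → α * x c + β * y c)) α β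
      (λ r r≢k c → trans (other-row A x r≢k c) (sym (other-row A _ r≢k c)))
      (λ r r≢k c → trans (other-row A y r≢k c) (sym (other-row A _ r≢k c)))
      (λ c → trans (updated-row A k _ c) (sym (+-cong (*-congˡ (updated-row A k x c)) (*-congˡ (updated-row A k y c)))))

    additive-at : ∀ (A : Mat n) k (x y : Row n) →
                  D (A [ k ]≔ (λ c → x c + y c)) ≈ D (A [ k ]≔ x) + D (A [ k ]≔ y)
    additive-at A k x y = begin
      D (A [ k ]≔ (λ c → x c + y c))                ≈˘⟨ cong (update-cong A k (λ c → +-cong (*-identityˡ (x c)) (*-identityˡ (y c)))) ⟩
      D (A [ k ]≔ (λ c → 1# * x c + 1# * y c))      ≈⟨ linear-at A k 1# 1# x y ⟩
      1# * D (A [ k ]≔ x) + 1# * D (A [ k ]≔ y)     ≈⟨ +-cong (*-identityˡ _) (*-identityˡ _) ⟩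
      D (A [ k ]≔ x) + D (A [ k ]≔ y)               ∎

    zero-row : ∀ (A : Mat n) k → D (A [ k ]≔ (λ _ → 0#)) ≈ 0#
    zero-row A k = begin
      D (A [ k ]≔ zeros)                                  ≈˘⟨ cong (update-cong A k (λ _ → 0*0+0*0≈0)) ⟩
      D (A [ k ]≔ (λ c → 0# * zeros c + 0# * zeros c))    ≈⟨ linear-at A k 0# 0# zeros zeros ⟩
      0# * D (A [ k ]≔ zeros) + 0# * D (A [ k ]≔ zeros)   ≈⟨ trans (+-cong (zeroˡ _) (zeroˡ _)) (+-identityˡ 0#) ⟩
      0#                                                  ∎
      where
      zeros : Row n
      zeros _ = 0#
      0*0+0*0≈0 : 0# * 0# + 0# * 0# ≈ 0#
      0*0+0*0≈0 = trans (+-cong (zeroˡ 0#) (zeroˡ 0#)) (+-identityˡ 0#)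

    sum-at : ∀ (A : Mat n) k {m} (a : Fin m → Carrier) (x : Fin m → Row n) →
             D (A [ k ]≔ (λ c → sum (λ j → a j * x j c))) ≈ sum (λ j → a j * D (A [ k ]≔ x j))
    sum-at A k {zero} a x = zero-row A k
    sum-at A k {suc m} a x = begin
      D (A [ k ]≔ (λ c → a zero * x zero c + rest c))       ≈˘⟨ cong (update-cong A k (λ c → +-congˡ (*-identityˡ (rest c)))) ⟩
      D (A [ k ]≔ (λ c → a zero * x zero c + 1# * rest c))  ≈⟨ linear-at A k (a zero) 1# (x zero) rest ⟩
      a zero * D (A [ k ]≔ x zero) + 1# * D (A [ k ]≔ rest) ≈⟨ +-congˡ (trans (*-identityˡ _) (sum-at A k (a ∘ suc) (x ∘ suc))) ⟩
      sum (λ j → a j * D (A [ k ]≔ x j))                    ∎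
      where
      rest : Row n
      rest c = sum (λ j → a (suc j) * x (suc j) c)

    row-expansion : ∀ (A : Mat n) k → D A ≈ sum (λ j → A k j * D (A [ k ]≔ I j))
    row-expansion A k = trans (cong A≋expanded) (sum-at A k (A k) I)
      where
      A≋expanded : A ≋ A [ k ]≔ (λ c → sum (λ j → A k j * I j c))
      A≋expanded r c with r ≟ k
      ... | yes ≡.refl = sym (trans (updated-row A r _ c) (sum-*I (A r) c))
      ... | no r≢k = sym (other-row A _ r≢k c)

    -- Expand 0 ≈ D (T S S), where rows p and q both hold S = A p + A q, additively in each row.
    swap-negates : ∀ (A : Mat n) {p q} → p ≢ q → (∀ B → (∀ c → B p c ≈ B q c) → D B ≈ 0#) →
                   D (A ∘ transpose p q) ≈ - D A
    swap-negates A {p} {q} p≢q vanish = inverseʳ-unique (D A) (D (A ∘ transpose p q)) D[A]+D[swapped]≈0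
      where
      T : Row n → Row n → Mat n
      T x y = A [ q ]≔ y [ p ]≔ x
      T-rows : ∀ x y (B : Mat n) → (∀ c → x c ≈ B p c) → (∀ c → y c ≈ B q c) →
               (∀ r → r ≢ p → r ≢ q → ∀ c → A r c ≈ B r c) → T x y ≋ B
      T-rows x y B x≈Bₚ y≈B_q A≈B r c with r ≟ p | r ≟ q
      ... | yes ≡.refl | _ = trans (updated-row _ p x c) (x≈Bₚ c)
      ... | no r≢p | yes ≡.refl = trans (other-row _ x r≢p c) (trans (updated-row A q y c) (y≈B_q c))
      ... | no r≢p | no r≢q = trans (other-row _ x r≢p c) (trans (other-row A y r≢q c) (A≈B r r≢p r≢q c))
      equal-rows : ∀ x → D (T x x) ≈ 0#
      equal-rows x = vanish (T x x) (λ c → trans (updated-row _ p x c)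
        (sym (trans (other-row _ x (p≢q ∘ ≡.sym) c) (updated-row A q x c))))
      additive-second : ∀ x y y′ → D (T x (λ c → y c + y′ c)) ≈ D (T x y) + D (T x y′)
      additive-second x y y′ = begin
        D (T x (λ c → y c + y′ c))                     ≈⟨ cong (commute _) ⟩
        D (A [ p ]≔ x [ q ]≔ (λ c → y c + y′ c))       ≈⟨ additive-at (A [ p ]≔ x) q y y′ ⟩
        D (A [ p ]≔ x [ q ]≔ y) + D (A [ p ]≔ x [ q ]≔ y′) ≈˘⟨ +-cong (cong (commute y)) (cong (commute y′)) ⟩
        D (T x y) + D (T x y′)                         ∎
        where
        commute : ∀ z → T x z ≋ A [ p ]≔ x [ q ]≔ z
        commute z = ≗⇒≋ (updateAt-commutes p q p≢q A)
      S : Row n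
      S c = A p c + A q c
      D[A]+D[swapped]≈0 : D A + D (A ∘ transpose p q) ≈ 0#
      D[A]+D[swapped]≈0 = begin
        D A + D (A ∘ transpose p q)
          ≈˘⟨ +-cong (cong (T-rows (A p) (A q) A (λ _ → refl) (λ _ → refl) (λ _ _ _ _ → refl)))
                     (cong (T-rows (A q) (A p) (A ∘ transpose p q)
                              (λ c → reflexive (≡.cong (λ r → A r c) (≡.sym (transpose-left p q))))
                              (λ c → reflexive (≡.cong (λ r → A r c) (≡.sym (transpose-right p≢q))))
                              (λ r r≢p r≢q c → reflexive (≡.cong (λ r → A r c) (≡.sym (transpose-other r≢p r≢q)))))) ⟩
        D (T (A p) (A q)) + D (T (A q) (A p))
          ≈˘⟨ +-cong (trans (+-congʳ (equal-rows (A p))) (+-identityˡ _))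
                     (trans (+-congˡ (equal-rows (A q))) (+-identityʳ _)) ⟩
        (D (T (A p) (A p)) + D (T (A p) (A q))) + (D (T (A q) (A p)) + D (T (A q) (A q)))
          ≈˘⟨ +-cong (additive-second (A p) (A p) (A q)) (additive-second (A q) (A p) (A q)) ⟩
        D (T (A p) S) + D (T (A q) S)  ≈˘⟨ additive-at (A [ q ]≔ S) p (A p) (A q) ⟩
        D (T S S)                      ≈⟨ equal-rows S ⟩
        0#                             ∎

    alternating-at-gap : ∀ d (B : Mat n) {p q} → toℕ q ≡ suc (toℕ p ℕ.+ d) → (∀ c → B p c ≈ B q c) → D B ≈ 0#
    alternating-at-gap zero B {p} {q} q≡p+1 Bₚ≈B_q =
      adjacent-alternating (toℕ⇒adjacent (≡.trans q≡p+1 (≡.cong suc (ℕP.+-identityʳ _)))) B Bₚ≈B_q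
    alternating-at-gap (suc d) B {p} {q} q≡p+2+d Bₚ≈B_q = begin
      D B                            ≈˘⟨ -‿involutive (D B) ⟩
      - (- D B)                      ≈˘⟨ -‿cong (swap-negates B p≢p′ (adjacent-alternating p~p′)) ⟩
      - D (B ∘ transpose p p′)       ≈⟨ -‿cong (alternating-at-gap d (B ∘ transpose p p′) q≡p′+1+d equal) ⟩
      - 0#                           ≈⟨ ε⁻¹≈ε ⟩
      0#                             ∎
      where
      q≡p+1+[1+d] : toℕ q ≡ suc (suc (toℕ p ℕ.+ d))
      q≡p+1+[1+d] = ≡.trans q≡p+2+d (≡.cong suc (ℕP.+-suc _ d))
      p′ : Fin n
      p′ = fromℕ< {suc (toℕ p)} (ℕP.<-≤-trans (ℕ.s≤s (ℕ.s≤s (ℕP.m≤m+n (toℕ p) d)))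
                                            (ℕP.≤-trans (ℕP.≤-reflexive (≡.sym q≡p+1+[1+d])) (ℕP.<⇒≤ (toℕ<n q))))
      p′≡p+1 : toℕ p′ ≡ suc (toℕ p)
      p′≡p+1 = toℕ-fromℕ< _
      p~p′ = toℕ⇒adjacent p′≡p+1
      p≢p′ = adjacent⇒≢ p~p′
      q≡p′+1+d : toℕ q ≡ suc (toℕ p′ ℕ.+ d)
      q≡p′+1+d = ≡.trans q≡p+1+[1+d] (≡.cong (λ z → suc (z ℕ.+ d)) (≡.sym p′≡p+1))
      q≢p : q ≢ p
      q≢p e = ℕP.m≢1+m+n (toℕ p) (≡.trans (≡.cong toℕ (≡.sym e)) q≡p+2+d)
      q≢p′ : q ≢ p′
      q≢p′ e = ℕP.m≢1+m+n (toℕ p′) (≡.trans (≡.cong toℕ (≡.sym e)) q≡p′+1+d)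
      equal : ∀ c → B (transpose p p′ p′) c ≈ B (transpose p p′ q) c
      equal c = trans (reflexive (≡.cong (λ r → B r c) (transpose-right p≢p′)))
                      (trans (Bₚ≈B_q c) (reflexive (≡.cong (λ r → B r c) (≡.sym (transpose-other q≢p q≢p′)))))

    alternating : ∀ (A : Mat n) {p q} → p ≢ q → (∀ c → A p c ≈ A q c) → D A ≈ 0#
    alternating A {p} {q} p≢q Aₚ≈A_q with ℕP.<-cmp (toℕ p) (toℕ q)
    ... | tri≈ _ e _ = ⊥-elim (p≢q (toℕ-injective e))
    ... | tri< p<q _ _ = alternating-at-gap _ A (≡.sym (proj₂ (ℕP.m≤n⇒∃[o]m+o≡n p<q))) Aₚ≈A_q
    ... | tri> _ _ q<p = alternating-at-gap _ A (≡.sym (proj₂ (ℕP.m≤n⇒∃[o]m+o≡n q<p))) (λ c → sym (Aₚ≈A_q c))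

  selection : ∀ {n} → (Fin n → Fin n) → Mat n
  selection τ r = I (τ r)

  -- s is the sign of τ, and 0 when τ is not injective.
  Determined : ∀ {n} → (Fin n → Fin n) → Set (c ⊔ ℓ)
  Determined {n} τ = Σ Carrier λ s → ∀ {D : Mat n → Carrier} → Multilinear D → D (selection τ) ≈ s * D I

  determined-identity : ∀ {n} {τ : Fin n → Fin n} → (∀ r → τ r ≡ r) → Determined τ
  determined-identity τr≡r = 1# , λ D-ml →
    trans (Multilinear.cong D-ml (λ r c → reflexive (≡.cong (λ z → I z c) (τr≡r r)))) (sym (*-identityˡ _))

  determined-collision : ∀ {n} {τ : Fin n → Fin n} {p q} → p ≢ q → τ p ≡ τ q → Determined τ
  determined-collision {τ = τ} p≢q τp≡τq = 0# , λ D-ml →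
    trans (alternating D-ml (selection τ) p≢q (λ c → reflexive (≡.cong (λ z → I z c) τp≡τq))) (sym (zeroˡ _))

  determined-transpose : ∀ {n} {τ : Fin n → Fin n} {p q} → p ≢ q → Determined (τ ∘ transpose p q) → Determined τ
  determined-transpose {τ = τ} {p} {q} p≢q (s , value) = - s , λ {D} D-ml → begin
    D (selection τ)                      ≈˘⟨ -‿involutive _ ⟩
    - (- D (selection τ))                ≈˘⟨ -‿cong (swap-negates D-ml (selection τ) p≢q (λ B → alternating D-ml B p≢q)) ⟩
    - D (selection (τ ∘ transpose p q))  ≈⟨ -‿cong (value D-ml) ⟩
    - (s * D I)                          ≈⟨ -‿distribˡ-* s (D I) ⟩
    - s * D I                            ∎

  missed-value⇒collision : ∀ {n} (τ : Fin n → Fin n) k → (∀ r → τ r ≢ k) → ∃₂ λ p q → p ≢ q × τ p ≡ τ q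
  missed-value⇒collision {suc m} τ k miss with pigeonhole (ℕP.n<1+n m) (λ r → punchOut (miss r ∘ ≡.sym))
  ... | p , q , p<q , e = p , q , FinP.<⇒≢ p<q , punchOut-injective (miss p ∘ ≡.sym) (miss q ∘ ≡.sym) e

  fixed-below-suc : ∀ {n} {τ : Fin n → Fin n} {k} (kᶠ : Fin n) → toℕ kᶠ ≡ k → τ kᶠ ≡ kᶠ →
                    (∀ r → toℕ r ℕ.< k → τ r ≡ r) → ∀ r → toℕ r ℕ.< suc k → τ r ≡ r
  fixed-below-suc {τ = τ} kᶠ kᶠ≡k τkᶠ≡kᶠ fixed r r<1+k with ℕP.m<1+n⇒m<n∨m≡n r<1+k
  ... | inj₁ r<k = fixed r r<k
  ... | inj₂ r≡k = ≡.subst (λ z → τ z ≡ z) (toℕ-injective (≡.trans kᶠ≡k (≡.sym r≡k))) τkᶠ≡kᶠ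

  -- Selection sort: fix the rows below k one at a time by transpositions.
  determined-fixed-below : ∀ {n} d k (τ : Fin n → Fin n) → k ℕ.+ d ≡ n → (∀ r → toℕ r ℕ.< k → τ r ≡ r) → Determined τ
  determined-fixed-below zero k τ k+0≡n fixed =
    determined-identity (λ r → fixed r (≡.subst (toℕ r ℕ.<_) (≡.trans (≡.sym k+0≡n) (ℕP.+-identityʳ k)) (toℕ<n r)))
  determined-fixed-below {n} (suc d) k τ k+[1+d]≡n fixed = fix (fromℕ< k<n) (toℕ-fromℕ< k<n)
    where
    k<n : k ℕ.< n
    k<n = ℕP.<-≤-trans (ℕP.m<m+n k ℕ.z<s) (ℕP.≤-reflexive k+[1+d]≡n)
    [1+k]+d≡n : suc k ℕ.+ d ≡ n
    [1+k]+d≡n = ≡.trans (≡.sym (ℕP.+-suc k d)) k+[1+d]≡n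
    fix : ∀ kᶠ → toℕ kᶠ ≡ k → Determined τ
    fix kᶠ kᶠ≡k with any? (λ r → τ r ≟ kᶠ)
    ... | no miss = let p , q , p≢q , τp≡τq = missed-value⇒collision τ kᶠ (λ r → miss ∘ (r ,_))
                    in determined-collision {τ = τ} p≢q τp≡τq
    ... | yes (r , τr≡kᶠ) with kᶠ ≟ r
    ...   | yes ≡.refl = determined-fixed-below d (suc k) τ [1+k]+d≡n (fixed-below-suc kᶠ kᶠ≡k τr≡kᶠ fixed)
    ...   | no kᶠ≢r = determined-transpose {τ = τ} kᶠ≢r
            (determined-fixed-below d (suc k) (τ ∘ transpose kᶠ r) [1+k]+d≡n
              (fixed-below-suc kᶠ kᶠ≡k (≡.trans (≡.cong τ (transpose-left kᶠ r)) τr≡kᶠ) still-fixed))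
      where
      still-fixed : ∀ r′ → toℕ r′ ℕ.< k → τ (transpose kᶠ r r′) ≡ r′
      still-fixed r′ r′<k = ≡.trans (≡.cong τ (transpose-other r′≢kᶠ r′≢r)) (fixed r′ r′<k)
        where
        r′≢kᶠ : r′ ≢ kᶠ
        r′≢kᶠ r′≡kᶠ = ℕP.<⇒≢ r′<k (≡.trans (≡.cong toℕ r′≡kᶠ) kᶠ≡k)
        r′≢r : r′ ≢ r
        r′≢r ≡.refl = kᶠ≢r (≡.trans (≡.sym τr≡kᶠ) (fixed r′ r′<k))

  determined : ∀ {n} (τ : Fin n → Fin n) → Determined τ
  determined {n} τ = determined-fixed-below n 0 τ ≡.refl (λ r ())

  module _ {n} {D₁ D₂ : Mat n → Carrier} (D₁-ml : Multilinear D₁) (D₂-ml : Multilinear D₂)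
           (agree : ∀ τ → D₁ (selection τ) ≈ D₂ (selection τ)) where

    StandardFrom : ℕ → Mat n → Set ℓ
    StandardFrom k A = ∀ r → k ℕ.≤ toℕ r → ∃ λ j → ∀ c → A r c ≈ I j c

    agree-standard-from : ∀ k A → StandardFrom k A → D₁ A ≈ D₂ A
    agree-standard-from zero A standard =
      trans (Multilinear.cong D₁-ml A≋selection) (trans (agree (λ r → proj₁ (standard r ℕ.z≤n))) (sym (Multilinear.cong D₂-ml A≋selection)))
      where
      A≋selection : A ≋ selection (λ r → proj₁ (standard r ℕ.z≤n))
      A≋selection r = proj₂ (standard r ℕ.z≤n)
    agree-standard-from (suc k) A standard with k ℕP.<? n
    ... | no k≮n = agree-standard-from k A (λ r k≤r → ⊥-elim (k≮n (ℕP.≤-<-trans k≤r (toℕ<n r))))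
    ... | yes k<n = begin
      D₁ A                                    ≈⟨ row-expansion D₁-ml A kᶠ ⟩
      sum (λ j → A kᶠ j * D₁ (A [ kᶠ ]≔ I j)) ≈⟨ sum-cong (λ j → *-congˡ (agree-standard-from k _ (standard-updated j))) ⟩
      sum (λ j → A kᶠ j * D₂ (A [ kᶠ ]≔ I j)) ≈˘⟨ row-expansion D₂-ml A kᶠ ⟩
      D₂ A                                    ∎
      where
      kᶠ = fromℕ< k<n
      standard-updated : ∀ j → StandardFrom k (A [ kᶠ ]≔ I j)
      standard-updated j r k≤r with r ≟ kᶠ
      ... | yes ≡.refl = j , updated-row A r (I j)
      ... | no r≢kᶠ = let j′ , Aᵣ≈Iⱼ′ = standard r (ℕP.≤∧≢⇒< k≤r k≢r) in j′ , λ c → trans (other-row A _ r≢kᶠ c) (Aᵣ≈Iⱼ′ c)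
        where
        k≢r : k ≢ toℕ r
        k≢r k≡r = r≢kᶠ (toℕ-injective (≡.trans (≡.sym k≡r) (≡.sym (toℕ-fromℕ< k<n))))

    agree-everywhere : ∀ A → D₁ A ≈ D₂ A
    agree-everywhere A = agree-standard-from n A (λ r n≤r → ⊥-elim (ℕP.<⇒≱ (toℕ<n r) n≤r))

  det-identity : ∀ {n} → det (I {n}) ≈ 1#
  det-identity {zero} = refl
  det-identity {suc n} = begin
    det (I {suc n})                            ≈⟨ sum-single term zero other-terms ⟩
    1# * (1# * det (minor zero (I {suc n})))   ≈⟨ trans (*-identityˡ _) (*-identityˡ _) ⟩
    det (minor zero (I {suc n}))               ≈⟨ det-cong {n} I-suc ⟩
    det (I {n})                                ≈⟨ det-identity {n} ⟩
    1#                                         ∎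
    where
    term : Fin (suc n) → Carrier
    term i = sign (toℕ i) * (I i zero * det (minor i I))
    other-terms : ∀ i → i ≢ zero → term i ≈ 0#
    other-terms i i≢0 = trans (*-congˡ (trans (*-congʳ (I-off-diagonal i≢0)) (zeroˡ _))) (zeroʳ _)

  det-scaled-multilinear : ∀ {n} x → Multilinear (λ (A : Mat n) → det A * x)
  det-scaled-multilinear x = record
    { cong = λ A≋B → *-congʳ (det-cong A≋B)
    ; row-linear = λ k A B C α β A≈C B≈C Cₖ →
        trans (*-congʳ (det-row-linear k A B C α β A≈C B≈C Cₖ)) (distribute _ _ α β)
    ; adjacent-alternating = λ p~q A Aₚ≈A_q → trans (*-congʳ (det-adjacent-alternating p~q A Aₚ≈A_q)) (zeroˡ x)
    }
    where
    distribute : ∀ a b α β → (α * a + β * b) * x ≈ α * (a * x) + β * (b * x)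
    distribute a b α β = solve 5 (λ a b p q y → (p :* a :+ q :* b) :* y := p :* (a :* y) :+ q :* (b :* y)) refl a b α β x

  multilinear-unique : ∀ {n} {D : Mat n → Carrier} → Multilinear D → ∀ A → D A ≈ det A * D I
  multilinear-unique {n} {D} D-ml = agree-everywhere D-ml (det-scaled-multilinear (D I)) on-selections
    where
    on-selections : ∀ τ → D (selection τ) ≈ det (selection τ) * D I
    on-selections τ with determined τ
    ... | s , value = trans (value D-ml)
                           (*-congʳ (sym (trans (value det-multilinear) (trans (*-congˡ (det-identity {n})) (*-identityʳ s)))))

  ⊗-multilinear : ∀ {n} (B : Mat n) → Multilinear (λ A → det (A ⊗ B))
  ⊗-multilinear B = record
    { cong = λ A≋A′ → det-cong (⊗-congˡ B A≋A′)
    ; row-linear = λ k A₁ A₂ C α β A₁≈C A₂≈C Cₖ →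
        det-row-linear k (A₁ ⊗ B) (A₂ ⊗ B) (C ⊗ B) α β
          (λ r r≢k c → sum-cong (λ j → *-congʳ (A₁≈C r r≢k j)))
          (λ r r≢k c → sum-cong (λ j → *-congʳ (A₂≈C r r≢k j)))
          (λ c → row-k A₁ A₂ C α β Cₖ c)
    ; adjacent-alternating = λ p~q A Aₚ≈A_q →
        det-adjacent-alternating p~q (A ⊗ B) (λ c → sum-cong (λ j → *-congʳ (Aₚ≈A_q j)))
    }
    where
    row-k : ∀ {k} A₁ A₂ C α β → (∀ c → C k c ≈ α * A₁ k c + β * A₂ k c) →
            ∀ c → (C ⊗ B) k c ≈ α * (A₁ ⊗ B) k c + β * (A₂ ⊗ B) k c
    row-k {k} A₁ A₂ C α β Cₖ c = begin
      sum (λ j → C k j * B j c)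
        ≈⟨ sum-cong (λ j → trans (*-congʳ (Cₖ j)) (distribute (A₁ k j) (A₂ k j) (B j c))) ⟩
      sum (λ j → α * (A₁ k j * B j c) + β * (A₂ k j * B j c))
        ≈⟨ ∑-distrib-+ (λ j → α * (A₁ k j * B j c)) (λ j → β * (A₂ k j * B j c)) ⟩
      sum (λ j → α * (A₁ k j * B j c)) + sum (λ j → β * (A₂ k j * B j c))
        ≈˘⟨ +-cong (*-distribˡ-sum α (λ j → A₁ k j * B j c)) (*-distribˡ-sum β (λ j → A₂ k j * B j c)) ⟩
      α * (A₁ ⊗ B) k c + β * (A₂ ⊗ B) k c ∎
      where
      distribute : ∀ a b y → (α * a + β * b) * y ≈ α * (a * y) + β * (b * y)
      distribute = solve 5 (λ p q a b y → (p :* a :+ q :* b) :* y := p :* (a :* y) :+ q :* (b :* y)) refl α β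

  det-⊗ : ∀ {n} (A B : Mat n) → det (A ⊗ B) ≈ det A * det B
  det-⊗ A B = trans (multilinear-unique (⊗-multilinear B) A) (*-congˡ (det-cong (⊗-identityˡ B)))

  adjugate : ∀ {n} → Mat n → Mat n
  adjugate M j k = det (M [ k ]≔ I j)

  ⊗-adjugate : ∀ {n} (M : Mat n) → M ⊗ adjugate M ≋ det M · I
  ⊗-adjugate M i k = begin
    sum (λ j → M i j * det (M [ k ]≔ I j))        ≈˘⟨ sum-at det-multilinear M k (M i) I ⟩
    det (M [ k ]≔ (λ c → sum (λ j → M i j * I j c))) ≈⟨ det-cong (update-cong M k (sum-*I (M i))) ⟩
    det (M [ k ]≔ M i)                            ≈⟨ row-i-at-k (i ≟ k) ⟩
    det M * I i k                                 ∎
    where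
    row-i-at-k : Dec (i ≡ k) → det (M [ k ]≔ M i) ≈ det M * I i k
    row-i-at-k (yes ≡.refl) = begin
      det (M [ i ]≔ M i)  ≈⟨ det-cong (≗⇒≋ (updateAt-id-local i M ≡.refl)) ⟩
      det M               ≈˘⟨ trans (*-congˡ (I-diagonal i)) (*-identityʳ _) ⟩
      det M * I i i       ∎
    row-i-at-k (no i≢k) = begin
      det (M [ k ]≔ M i)  ≈⟨ alternating det-multilinear _ i≢k (λ c → trans (other-row M _ i≢k c) (sym (updated-row M k (M i) c))) ⟩
      0#                  ≈˘⟨ trans (*-congˡ (I-off-diagonal i≢k)) (zeroʳ _) ⟩
      det M * I i k       ∎

  left-inverse⇒right-inverse : ∀ {n} (Φ Ψ : Mat n) → Ψ ⊗ Φ ≋ I → Φ ⊗ Ψ ≋ I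
  left-inverse⇒right-inverse {n} Φ Ψ ΨΦ≋I = ≋-trans (⊗-congʳ Φ Ψ≋Ψ′) ΦΨ′≋I
    where
    det-Ψ*det-Φ≈1 : det Ψ * det Φ ≈ 1#
    det-Ψ*det-Φ≈1 = trans (sym (det-⊗ Ψ Φ)) (trans (det-cong ΨΦ≋I) (det-identity {n}))
    Ψ′ = det Ψ · adjugate Φ
    ΦΨ′≋I : Φ ⊗ Ψ′ ≋ I
    ΦΨ′≋I i k = begin
      (Φ ⊗ Ψ′) i k                 ≈⟨ ⊗-· (det Ψ) Φ (adjugate Φ) i k ⟩
      det Ψ * (Φ ⊗ adjugate Φ) i k ≈⟨ *-congˡ (⊗-adjugate Φ i k) ⟩
      det Ψ * (det Φ * I i k)      ≈˘⟨ *-assoc _ _ _ ⟩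
      (det Ψ * det Φ) * I i k      ≈⟨ trans (*-congʳ det-Ψ*det-Φ≈1) (*-identityˡ _) ⟩
      I i k                        ∎
    Ψ≋Ψ′ : Ψ ≋ Ψ′
    Ψ≋Ψ′ = ≋-trans (≋-sym (⊗-identityʳ Ψ)) (≋-trans (⊗-congʳ Ψ (≋-sym ΦΨ′≋I))
            (≋-trans (≋-sym (⊗-assoc Ψ Φ Ψ′)) (≋-trans (⊗-congˡ Ψ′ ΨΦ≋I) (⊗-identityˡ Ψ′))))

module Idempotents {c ℓ} (R : CommutativeRing c ℓ) where
  open CommutativeRing R hiding (zero)
  open MatrixAlgebra R
  open Determinant R using (det)
  open MultilinearForms R using (adjugate; ⊗-adjugate)
  open GroupProperties +-group using (identityˡ-unique)
  open import Relation.Binary.Reasoning.Setoid setoid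

  module _ {n} {u : Mat n} (u²≋u : u ⊗ u ≋ u) where

    idempotent⇒u⊗[I⊖u]≋O : u ⊗ (I ⊖ u) ≋ O
    idempotent⇒u⊗[I⊖u]≋O p q = identityˡ-unique ((u ⊗ (I ⊖ u)) p q) (u p q) (begin
      (u ⊗ (I ⊖ u)) p q + u p q                 ≈˘⟨ +-congˡ (u²≋u p q) ⟩
      (u ⊗ (I ⊖ u)) p q + (u ⊗ u) p q           ≈˘⟨ ∑-distrib-+ (λ j → u p j * (I ⊖ u) j q) (λ j → u p j * u j q) ⟩
      sum (λ j → u p j * (I ⊖ u) j q + u p j * u j q) ≈˘⟨ sum-cong (λ j → distribˡ (u p j) ((I ⊖ u) j q) (u j q)) ⟩
      sum (λ j → u p j * ((I ⊖ u) j q + u j q)) ≈⟨ sum-cong (λ j → *-congˡ (I⊖u+u≈I j)) ⟩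
      sum (λ j → u p j * I j q)                 ≈⟨ sum-*I (u p) q ⟩
      u p q                                     ∎)
      where
      I⊖u+u≈I : ∀ j → (I ⊖ u) j q + u j q ≈ I j q
      I⊖u+u≈I j = trans (+-assoc _ _ _) (trans (+-congˡ (-‿inverseˡ (u j q))) (+-identityʳ _))

    idempotent⇒det[I⊖u]*u≈0 : ∀ p q → det (I ⊖ u) * u p q ≈ 0#
    idempotent⇒det[I⊖u]*u≈0 p q = begin
      det M * u p q                 ≈˘⟨ *-congˡ (⊗-identityʳ u p q) ⟩
      det M * (u ⊗ I) p q           ≈˘⟨ ⊗-· (det M) u I p q ⟩
      (u ⊗ (det M · I)) p q         ≈˘⟨ ⊗-congʳ u (⊗-adjugate M) p q ⟩
      (u ⊗ (M ⊗ adjugate M)) p q    ≈˘⟨ ⊗-assoc u M (adjugate M) p q ⟩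
      ((u ⊗ M) ⊗ adjugate M) p q    ≈⟨ ⊗-congˡ (adjugate M) idempotent⇒u⊗[I⊖u]≋O p q ⟩
      (O ⊗ adjugate M) p q          ≈⟨ ⊗-zeroˡ (adjugate M) p q ⟩
      0#                            ∎
      where
      M = I ⊖ u

module DualBases {c ℓ} (R : CommutativeRing c ℓ) where
  open CommutativeRing R
  open MatrixAlgebra R
  open MultilinearForms R using (left-inverse⇒right-inverse)
  open import Relation.Binary.Reasoning.Setoid setoid

  sum-flatten : ∀ {n} (f : Fin n → Fin n → Carrier) → sum (flatten f) ≈ sum (λ p → sum (λ q → f p q))
  sum-flatten {n} f = trans (sum-combine {n} {n} (flatten {n = n} f))
    (sum-cong (λ p → sum-cong (λ q → reflexive (≡.cong (uncurry f) (remQuot-combine p q)))))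

  I-flatten : ∀ {n} (x y : Fin (n ℕ.* n)) → I x y ≈ flatten {n = n} (λ p q → flatten {n = n} (λ p′ q′ → I p p′ * I q q′) y) x
  I-flatten {n} x y with x ≟ y
  ... | yes ≡.refl = sym (trans (*-cong (I-diagonal (proj₁ (remQuot {n} n x))) (I-diagonal (proj₂ (remQuot {n} n x)))) (*-identityˡ 1#))
  ... | no x≢y with proj₁ (remQuot {n} n x) ≟ proj₁ (remQuot {n} n y) | proj₂ (remQuot {n} n x) ≟ proj₂ (remQuot {n} n y)
  ...   | yes e₁ | yes e₂ = ⊥-elim (x≢y (≡.trans (≡.sym (combine-remQuot {n} n x))
                                         (≡.trans (≡.cong₂ combine e₁ e₂) (combine-remQuot {n} n y))))
  ...   | no _ | _ = sym (zeroˡ _)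
  ...   | yes _ | no _ = sym (zeroʳ _)

  -- Flattened to vectors of length n², the dual family is a left inverse, hence a right inverse, of
  -- the family.
  dual-family-spans : ∀ {n} (Φ Ψ : Fin n → Fin n → Mat n) → (∀ i j k l → ⟨ Ψ i j , Φ k l ⟩ ≈ I i k * I j l) →
                      ∀ W r s → W r s ≈ sum (λ i → sum (λ j → ⟨ Ψ i j , W ⟩ * Φ i j r s))
  dual-family-spans {n} Φ Ψ dual W r s =
    ≡.subst (λ w → w ≈ sum (λ i → sum (λ j → ⟨ Ψ i j , W ⟩ * Φ i j r s)))
            (≡.cong (uncurry W) (remQuot-combine r s))
            (trans (flat-entry (combine r s))
                   (reflexive (≡.cong (λ rs → sum (λ i → sum (λ j → ⟨ Ψ i j , W ⟩ * uncurry (Φ i j) rs))) (remQuot-combine r s))))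
    where
    Φ̂ Ψ̂ Ŵ : Mat (n ℕ.* n)
    Φ̂ x y = flatten (flatten Φ y) x
    Ψ̂ x y = flatten (flatten Ψ x) y
    Ŵ x _ = flatten W x
    Ψ̂Φ̂≋I : Ψ̂ ⊗ Φ̂ ≋ I
    Ψ̂Φ̂≋I x y = begin
      sum (λ z → Ψ̂ x z * Φ̂ z y)          ≈⟨ sum-flatten {n} (λ p q → flatten Ψ x p q * flatten Φ y p q) ⟩
      ⟨ flatten Ψ x , flatten Φ y ⟩       ≈⟨ dual _ _ _ _ ⟩
      flatten {n = n} (λ p q → flatten {n = n} (λ p′ q′ → I p p′ * I q q′) y) x ≈˘⟨ I-flatten {n} x y ⟩
      I x y                               ∎
    Φ̂Ψ̂≋I : Φ̂ ⊗ Ψ̂ ≋ I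
    Φ̂Ψ̂≋I = left-inverse⇒right-inverse Φ̂ Ψ̂ Ψ̂Φ̂≋I
    flat-entry : ∀ a → flatten W a ≈ sum (λ i → sum (λ j → ⟨ Ψ i j , W ⟩ * flatten (Φ i j) a))
    flat-entry a = begin
      Ŵ a a                                       ≈˘⟨ ⊗-identityˡ Ŵ a a ⟩
      (I ⊗ Ŵ) a a                                 ≈˘⟨ ⊗-congˡ Ŵ Φ̂Ψ̂≋I a a ⟩
      ((Φ̂ ⊗ Ψ̂) ⊗ Ŵ) a a                           ≈⟨ ⊗-assoc Φ̂ Ψ̂ Ŵ a a ⟩
      sum (λ x → Φ̂ a x * (Ψ̂ ⊗ Ŵ) x a)             ≈⟨ sum-cong (λ x → *-congˡ (sum-flatten (λ p q → flatten Ψ x p q * W p q))) ⟩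
      sum (λ x → Φ̂ a x * ⟨ flatten Ψ x , W ⟩)     ≈⟨ sum-flatten (λ i j → flatten (Φ i j) a * ⟨ Ψ i j , W ⟩) ⟩
      sum (λ i → sum (λ j → flatten (Φ i j) a * ⟨ Ψ i j , W ⟩))
                                                  ≈⟨ sum-cong (λ i → sum-cong (λ j → *-comm (flatten (Φ i j) a) ⟨ Ψ i j , W ⟩)) ⟩
      sum (λ i → sum (λ j → ⟨ Ψ i j , W ⟩ * flatten (Φ i j) a)) ∎

module MatrixUnits {c ℓ} (F : Field c ℓ) where
  open Field F hiding (zero)
  open MatrixAlgebra commutativeRing
  open Determinant commutativeRing using (det; det[I⊖u]≡1-mod-entries)
  open Idempotents commutativeRing using (idempotent⇒det[I⊖u]*u≈0)
  open DualBases commutativeRing using (dual-family-spans)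
  open import Relation.Binary.Reasoning.Setoid setoid

  -- Equality in F need not be decidable, so no nonzero entry of u can be located; instead, the combination
  -- y = ⟨ C , u ⟩ of entries with det (I ⊖ u) + y ≈ 1 satisfies y · u ≈ u, so y is invertible.
  nonzero-idempotent⇒pairing-one : ∀ {n} (u : Mat n) → u ⊗ u ≋ u → ¬ (u ≋ O) → ∃ λ C → ⟨ C , u ⟩ ≈ 1#
  nonzero-idempotent⇒pairing-one u u²≋u u≉O = y⁻¹ · C , (begin
    ⟨ y⁻¹ · C , u ⟩  ≈⟨ ⟨⟩-comm (y⁻¹ · C) u ⟩
    ⟨ u , y⁻¹ · C ⟩  ≈⟨ ⟨⟩-·ʳ u y⁻¹ C ⟩
    y⁻¹ * ⟨ u , C ⟩  ≈⟨ *-congˡ (⟨⟩-comm u C) ⟩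
    y⁻¹ * y          ≈⟨ *-comm y⁻¹ y ⟩
    y * y⁻¹          ≈⟨ proj₂ (inverse y y≉0) ⟩
    1#               ∎)
    where
    C = proj₁ (det[I⊖u]≡1-mod-entries u)
    y = ⟨ C , u ⟩
    y*u≈u : ∀ p q → y * u p q ≈ u p q
    y*u≈u p q = begin
      y * u p q                         ≈˘⟨ +-identityˡ _ ⟩
      0# + y * u p q                    ≈˘⟨ +-congʳ (idempotent⇒det[I⊖u]*u≈0 u²≋u p q) ⟩
      det (I ⊖ u) * u p q + y * u p q   ≈˘⟨ distribʳ (u p q) (det (I ⊖ u)) y ⟩
      (det (I ⊖ u) + y) * u p q         ≈⟨ *-congʳ (proj₂ (det[I⊖u]≡1-mod-entries u)) ⟩
      1# * u p q                        ≈⟨ *-identityˡ _ ⟩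
      u p q                             ∎
    y≉0 : ¬ (y ≈ 0#)
    y≉0 y≈0 = u≉O (λ p q → trans (sym (y*u≈u p q)) (trans (*-congʳ y≈0) (zeroˡ _)))
    y⁻¹ = proj₁ (inverse y y≉0)

  module _ {n} {U : Fin n → Fin n → Mat n} (units : UnitRelations U) (o : Fin n) (U≉O : ¬ (U o o ≋ O)) where
    private
      u = U o o
      u²≋u : u ⊗ u ≋ u
      u²≋u = ≋-trans (units o o o o) (λ p q → trans (*-congʳ (I-diagonal o)) (*-identityˡ _))
    C = proj₁ (nonzero-idempotent⇒pairing-one u u²≋u U≉O)
    ⟨C,u⟩≈1 = proj₂ (nonzero-idempotent⇒pairing-one u u²≋u U≉O)

    dual : Fin n → Fin n → Mat n
    dual i j = U o i ᵀ ⊗ (C ⊗ U j o ᵀ)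

    ⟨dual⟩ : ∀ i j X → ⟨ dual i j , X ⟩ ≈ ⟨ C , (U o i ⊗ X) ⊗ U j o ⟩
    ⟨dual⟩ i j X = sym (trans (⟨⟩-⊗ʳ C (U o i ⊗ X) (U j o)) (⟨⟩-⊗ˡ (C ⊗ U j o ᵀ) (U o i) X))

    ⟨dual,units⟩ : ∀ i j k l → ⟨ dual i j , U k l ⟩ ≈ I i k * I j l
    ⟨dual,units⟩ i j k l = begin
      ⟨ dual i j , U k l ⟩                      ≈⟨ ⟨dual⟩ i j (U k l) ⟩
      ⟨ C , (U o i ⊗ U k l) ⊗ U j o ⟩           ≈⟨ ⟨⟩-congʳ C (≋-trans (⊗-congˡ (U j o) (units o i k l)) (·-⊗ (I i k) (U o l) (U j o))) ⟩
      ⟨ C , I i k · (U o l ⊗ U j o) ⟩           ≈⟨ ⟨⟩-·ʳ C (I i k) (U o l ⊗ U j o) ⟩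
      I i k * ⟨ C , U o l ⊗ U j o ⟩             ≈⟨ *-congˡ (trans (⟨⟩-congʳ C (units o l j o)) (⟨⟩-·ʳ C (I l j) u)) ⟩
      I i k * (I l j * ⟨ C , u ⟩)               ≈⟨ *-congˡ (trans (*-congˡ ⟨C,u⟩≈1) (trans (*-identityʳ _) (I-sym l j))) ⟩
      I i k * I j l                             ∎

    Commutes : Mat n → Set ℓ
    Commutes W = ∀ s t → W ⊗ U s t ≋ U s t ⊗ W

    ⟨dual,commuting⟩ : ∀ {W} → Commutes W → ∀ i j → ⟨ dual i j , W ⟩ ≈ I i j * ⟨ C , W ⊗ u ⟩
    ⟨dual,commuting⟩ {W} commutes i j = begin
      ⟨ dual i j , W ⟩                   ≈⟨ ⟨dual⟩ i j W ⟩
      ⟨ C , (U o i ⊗ W) ⊗ U j o ⟩        ≈˘⟨ ⟨⟩-congʳ C (⊗-congˡ (U j o) (commutes o i)) ⟩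
      ⟨ C , (W ⊗ U o i) ⊗ U j o ⟩        ≈⟨ ⟨⟩-congʳ C (≋-trans (⊗-assoc W (U o i) (U j o)) (⊗-congʳ W (units o i j o))) ⟩
      ⟨ C , W ⊗ (I i j · u) ⟩            ≈⟨ ⟨⟩-congʳ C (⊗-· (I i j) W u) ⟩
      ⟨ C , I i j · (W ⊗ u) ⟩            ≈⟨ ⟨⟩-·ʳ C (I i j) (W ⊗ u) ⟩
      I i j * ⟨ C , W ⊗ u ⟩              ∎

    commuting≈multiple-of-diagonal : ∀ {W} → Commutes W → ∀ r s → W r s ≈ ⟨ C , W ⊗ u ⟩ * sum (λ i → U i i r s)
    commuting≈multiple-of-diagonal {W} commutes r s = begin
      W r s                                               ≈⟨ dual-family-spans U dual ⟨dual,units⟩ W r s ⟩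
      sum (λ i → sum (λ j → ⟨ dual i j , W ⟩ * U i j r s)) ≈⟨ sum-cong (λ i → trans (sum-cong (λ j → coordinate i j)) (sum-I* _ i)) ⟩
      sum (λ i → λ-W * U i i r s)                         ≈˘⟨ *-distribˡ-sum λ-W (λ i → U i i r s) ⟩
      λ-W * sum (λ i → U i i r s)                         ∎
      where
      λ-W = ⟨ C , W ⊗ u ⟩
      coordinate : ∀ i j → ⟨ dual i j , W ⟩ * U i j r s ≈ I i j * (λ-W * U i j r s)
      coordinate i j = trans (*-congʳ (⟨dual,commuting⟩ commutes i j)) (*-assoc _ _ _)

    commuting≈scalar : ∀ {W} → Commutes W → W ≋ ⟨ C , W ⊗ u ⟩ · I
    commuting≈scalar {W} commutes r s =
      trans (commuting≈multiple-of-diagonal commutes r s) (*-congˡ (sym diagonal≈I))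
      where
      I-commutes : Commutes I
      I-commutes s t = ≋-trans (⊗-identityˡ (U s t)) (≋-sym (⊗-identityʳ (U s t)))
      diagonal≈I : I r s ≈ sum (λ i → U i i r s)
      diagonal≈I = trans (commuting≈multiple-of-diagonal I-commutes r s)
        (trans (*-congʳ (trans (⟨⟩-congʳ C (⊗-identityˡ u)) ⟨C,u⟩≈1)) (*-identityˡ _))

module Centralizer {c ℓ} (F : Field c ℓ) where
  open Field F hiding (zero)
  open Matrices F using (ε; δ; InScalars; scalar)
  open MatrixAlgebra commutativeRing
  open MatrixUnits F

  scalar≋·I : ∀ {n} a → scalar {n} a ≋ a · I
  scalar≋·I a p q with p ≟ q
  ... | yes _ = sym (*-identityʳ a)
  ... | no _ = sym (zeroʳ a)

  ε⇒units : ∀ {n} {U : Fin n → Fin n → Mat n} → ε U → UnitRelations U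
  ε⇒units (compose , orthogonal) a b s t with b ≟ s
  ... | yes ≡.refl = λ p q → trans (proj₁ (compose a b t) p q) (sym (*-identityˡ _))
  ... | no b≢s = λ p q → trans (orthogonal a b s t b≢s p q) (sym (zeroˡ _))

  elementary-ε : ∀ {n} → ε (elementary {n})
  elementary-ε = (λ i j t → compose i j t , nonzero i t) , orthogonal
    where
    compose : ∀ i j t → elementary i j ⊗ elementary j t ≋ elementary i t
    compose i j t = ≋-trans (elementary-units i j j t) (λ p q → trans (*-congʳ (I-diagonal j)) (*-identityˡ _))
    nonzero : ∀ i t → ¬ (elementary i t ≋ O)
    nonzero i t E≋O = 0≉1 (sym (trans (sym (trans (*-cong (I-diagonal i) (I-diagonal t)) (*-identityˡ 1#))) (E≋O i t)))
    orthogonal : ∀ i j s t → j ≢ s → elementary i j ⊗ elementary s t ≋ O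
    orthogonal i j s t j≢s = ≋-trans (elementary-units i j s t) (λ p q → trans (*-congʳ (I-off-diagonal j≢s)) (zeroˡ _))

  scalar⇒commutes-with-units : ∀ {n} {V : Mat n} → InScalars V → ∃ λ (U : Fin n → Fin n → Mat n) → ε U × δ V U
  scalar⇒commutes-with-units (a , V≋a) = elementary , elementary-ε , λ s t →
    ≋-trans (⊗-congˡ (elementary s t) V≋aI) (≋-trans (·I-central a (elementary s t)) (⊗-congʳ (elementary s t) (≋-sym V≋aI)))
    where
    V≋aI = ≋-trans V≋a (scalar≋·I a)

  commutes-with-units⇒scalar : ∀ {m} {V : Mat (suc m)} → (∃ λ (U : Fin (suc m) → Fin (suc m) → Mat (suc m)) → ε U × δ V U) →
                               InScalars V
  commutes-with-units⇒scalar {V = V} (U , εU , δVU) = ⟨ C units zero U≉O , V ⊗ U zero zero ⟩ , λ r s →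
    trans (commuting≈scalar units zero U≉O {V} δVU r s) (sym (scalar≋·I _ r s))
    where
    units = ε⇒units εU
    U≉O = proj₂ (proj₁ εU zero zero zero)

corollary2p1p4 : ∀ {c ℓ} (F : Field c ℓ) (n : ℕ) → 1 ≤ n →
    let open Matrices F in
    (V : Mat n) →
      InScalars V ⇔ (∃ λ (U : Fin n → Fin n → Mat n) → ε U × δ V U)
corollary2p1p4 F (suc m) (s≤s z≤n) V = mk⇔ scalar⇒commutes-with-units commutes-with-units⇒scalar
  where open Centralizer F
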